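{- Consider the language of binding logic with a function symbol $f$ of binding arity $\langle 0\rangle$, a function symbol $\Lambda$ of binding arity $\langle 1\rangle$ and a predicate symbol $=$ of binding arity $\langle 0,0\rangle$, and let $E$ be the set of equality axioms $\forall x\,(x=x)$, $\forall x\forall y\,(x=y\Rightarrow y=x)$, $\forall x\forall y\forall z\,(x=y\Rightarrow(y=z\Rightarrow x=z))$, $\forall x\forall y\,(x=y\Rightarrow f(x)=f(y))$, $\forall x\forall y\,(x=y\Rightarrow \Lambda z\,x=\Lambda z\,y)$. Then there are instances of the extensionality scheme $(\forall x\,(t=u))\Rightarrow \Lambda x\,t=\Lambda x\,u$ (for terms $t,u$ and a variable $x$) that are not consequences of $E$, i.e. such that the sequent $E\vdash (\forall x\,(t=u))\Rightarrow \Lambda x\,t=\Lambda x\,u$ is not provable in binding logic.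
   Context: Binding logic: a language assigns to each function and predicate symbol a binding arity $\langle k_1,\ldots,k_n\rangle$; in a term $f(x^1_1\cdots x^1_{k_1}\,t_1,\ldots,x^n_1\cdots x^n_{k_n}\,t_n)$ the distinct variables $x^i_1,\ldots,x^i_{k_i}$ are bound in $t_i$ (similarly for atomic propositions); $\Lambda x\,t$ denotes $\Lambda(x\,t)$ and $\Lambda z\,x$ denotes $\Lambda(z\,x)$. Propositions are built with $\Rightarrow,\wedge,\vee,\bot,\forall,\exists$; terms and propositions are considered up to $\alpha$-equivalence, and substitution $(t/x)A$ avoids capture both by quantifiers and by variables bound by function/predicate symbols. Provability is in the classical sequent calculus LK (axiom, cut, structural rules, logical rules, quantifier rules using this capture-avoiding substitution, eigenvariable conditions as usual); "not a consequence of $E$" means the sequent with the axioms of $E$ on the left is not provable. -}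

module Defs where

open import Data.Nat using (ℕ; zero; suc; _+_)
open import Data.Fin using (Fin; zero; suc; _↑ˡ_)
open import Data.List using (List; []; _∷_; map)
open import Data.List.Relation.Binary.Permutation.Propositional using (_↭_)

-- Terms and propositions are represented with well-scoped de Bruijn indices,
-- so α-equivalent expressions are literally equal, and substitution below is
-- capture-avoiding both w.r.t. quantifiers and w.r.t. the binder of Λ.

data Tm (n : ℕ) : Set where
  var : Fin n → Tm n
  fun : Tm n → Tm n
  lam : Tm (suc n) → Tm n        -- Λ(x t), x bound in t (index 0)

infixr 5 _⇒_
infixr 6 _∨_
infixr 7 _∧_

data Fm (n : ℕ) : Set where
  _≐_ : Tm n → Tm n → Fm n
  _⇒_ : Fm n → Fm n → Fm n
  _∧_ : Fm n → Fm n → Fm n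
  _∨_ : Fm n → Fm n → Fm n
  ⊥′  : Fm n
  all : Fm (suc n) → Fm n
  ex  : Fm (suc n) → Fm n

Ren : ℕ → ℕ → Set
Ren n m = Fin n → Fin m

extR : ∀ {n m} → Ren n m → Ren (suc n) (suc m)
extR ρ zero    = zero
extR ρ (suc i) = suc (ρ i)

renT : ∀ {n m} → Ren n m → Tm n → Tm m
renT ρ (var i) = var (ρ i)
renT ρ (fun t) = fun (renT ρ t)
renT ρ (lam t) = lam (renT (extR ρ) t)

renF : ∀ {n m} → Ren n m → Fm n → Fm m
renF ρ (t ≐ u) = renT ρ t ≐ renT ρ u
renF ρ (A ⇒ B) = renF ρ A ⇒ renF ρ B
renF ρ (A ∧ B) = renF ρ A ∧ renF ρ B
renF ρ (A ∨ B) = renF ρ A ∨ renF ρ B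
renF ρ ⊥′      = ⊥′
renF ρ (all A) = all (renF (extR ρ) A)
renF ρ (ex A)  = ex (renF (extR ρ) A)

wkF : ∀ {n} → Fm n → Fm (suc n)
wkF = renF suc

Sub : ℕ → ℕ → Set
Sub n m = Fin n → Tm m

extS : ∀ {n m} → Sub n m → Sub (suc n) (suc m)
extS σ zero    = var zero
extS σ (suc i) = renT suc (σ i)

subT : ∀ {n m} → Sub n m → Tm n → Tm m
subT σ (var i) = σ i
subT σ (fun t) = fun (subT σ t)
subT σ (lam t) = lam (subT (extS σ) t)

subF : ∀ {n m} → Sub n m → Fm n → Fm m
subF σ (t ≐ u) = subT σ t ≐ subT σ u
subF σ (A ⇒ B) = subF σ A ⇒ subF σ B
subF σ (A ∧ B) = subF σ A ∧ subF σ B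
subF σ (A ∨ B) = subF σ A ∨ subF σ B
subF σ ⊥′      = ⊥′
subF σ (all A) = all (subF (extS σ) A)
subF σ (ex A)  = ex (subF (extS σ) A)

single : ∀ {n} → Tm n → Sub (suc n) n
single t zero    = t
single t (suc i) = var i

_[_] : ∀ {n} → Fm (suc n) → Tm n → Fm n
A [ t ] = subF (single t) A

-- Eigenvariable conditions are enforced by the fresh
-- variable (index 0) in the ∀R / ∃L premises.
data Prov : (n : ℕ) → List (Fm n) → List (Fm n) → Set where
  ax     : ∀ {n} {A : Fm n} → Prov n (A ∷ []) (A ∷ [])
  cut    : ∀ {n Γ Δ} (A : Fm n) → Prov n Γ (A ∷ Δ) → Prov n (A ∷ Γ) Δ → Prov n Γ Δ
  weakL  : ∀ {n Γ Δ} {A : Fm n} → Prov n Γ Δ → Prov n (A ∷ Γ) Δ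
  weakR  : ∀ {n Γ Δ} {A : Fm n} → Prov n Γ Δ → Prov n Γ (A ∷ Δ)
  contrL : ∀ {n Γ Δ} {A : Fm n} → Prov n (A ∷ A ∷ Γ) Δ → Prov n (A ∷ Γ) Δ
  contrR : ∀ {n Γ Δ} {A : Fm n} → Prov n Γ (A ∷ A ∷ Δ) → Prov n Γ (A ∷ Δ)
  exchL  : ∀ {n Γ Γ′ Δ} → Γ ↭ Γ′ → Prov n Γ Δ → Prov n Γ′ Δ
  exchR  : ∀ {n Γ Δ Δ′} → Δ ↭ Δ′ → Prov n Γ Δ → Prov n Γ Δ′
  ⊥L     : ∀ {n Γ Δ} → Prov n (⊥′ ∷ Γ) Δ
  ⇒L     : ∀ {n Γ Δ} {A B : Fm n} → Prov n Γ (A ∷ Δ) → Prov n (B ∷ Γ) Δ → Prov n ((A ⇒ B) ∷ Γ) Δ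
  ⇒R     : ∀ {n Γ Δ} {A B : Fm n} → Prov n (A ∷ Γ) (B ∷ Δ) → Prov n Γ ((A ⇒ B) ∷ Δ)
  ∧L     : ∀ {n Γ Δ} {A B : Fm n} → Prov n (A ∷ B ∷ Γ) Δ → Prov n ((A ∧ B) ∷ Γ) Δ
  ∧R     : ∀ {n Γ Δ} {A B : Fm n} → Prov n Γ (A ∷ Δ) → Prov n Γ (B ∷ Δ) → Prov n Γ ((A ∧ B) ∷ Δ)
  ∨L     : ∀ {n Γ Δ} {A B : Fm n} → Prov n (A ∷ Γ) Δ → Prov n (B ∷ Γ) Δ → Prov n ((A ∨ B) ∷ Γ) Δ
  ∨R     : ∀ {n Γ Δ} {A B : Fm n} → Prov n Γ (A ∷ B ∷ Δ) → Prov n Γ ((A ∨ B) ∷ Δ)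
  ∀L     : ∀ {n Γ Δ} {A : Fm (suc n)} (t : Tm n) → Prov n (A [ t ] ∷ Γ) Δ → Prov n (all A ∷ Γ) Δ
  ∀R     : ∀ {n Γ Δ} {A : Fm (suc n)} → Prov (suc n) (map wkF Γ) (A ∷ map wkF Δ) → Prov n Γ (all A ∷ Δ)
  ∃L     : ∀ {n Γ Δ} {A : Fm (suc n)} → Prov (suc n) (A ∷ map wkF Γ) (map wkF Δ) → Prov n (ex A ∷ Γ) Δ
  ∃R     : ∀ {n Γ Δ} {A : Fm (suc n)} (t : Tm n) → Prov n Γ (A [ t ] ∷ Δ) → Prov n Γ (ex A ∷ Δ)

v0 : ∀ {n} → Tm (suc n)
v0 = var zero
v1 : ∀ {n} → Tm (suc (suc n))
v1 = var (suc zero)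
v2 : ∀ {n} → Tm (suc (suc (suc n)))
v2 = var (suc (suc zero))

E : (n : ℕ) → List (Fm n)
E n =
    all (v0 ≐ v0)
  ∷ all (all (v1 ≐ v0 ⇒ v0 ≐ v1))
  ∷ all (all (all (v2 ≐ v1 ⇒ (v1 ≐ v0 ⇒ v2 ≐ v0))))
  ∷ all (all (v1 ≐ v0 ⇒ fun v1 ≐ fun v0))
  ∷ all (all (v1 ≐ v0 ⇒ lam v2 ≐ lam v1))                  -- ∀x∀y (x=y ⇒ Λz x = Λz y)
  ∷ []

Ext : ∀ {n} → Tm (suc n) → Tm (suc n) → Fm n
Ext t u = all (t ≐ u) ⇒ (lam t ≐ lam u)

liftF : ∀ {n} (k : ℕ) → Fm n → Fm (n + k)
liftF k = renF (λ i → i ↑ˡ k)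

-- LK is sound for structures in which Λ is an arbitrary operation on functions, not required to
-- respect the interpreted equality, so it suffices to find such a model of E in which ∀x (x = f(x))
-- holds but Λ x x = Λ x f(x) fails. Take three points with a = b as the only nontrivial equality,
-- let f swap a and b, and let Λ g be c when g fixes a and b and a otherwise. Then Λ x x = c and
-- Λ x f(x) = a, while the congruence axiom for Λ z x only applies Λ to constant functions, on which
-- it is constantly a.
module Submission where

open import Defs
open import Data.Nat using (ℕ; suc; _+_)
open import Data.Fin using (zero; suc; _↑ˡ_)
open import Data.Bool using (Bool; true; false; T) renaming (_∧_ to _∧ᵇ_; _∨_ to _∨ᵇ_)
open import Data.Bool.Properties using (T-∧; T-∨)
open import Data.Bool.ListAction using (and; or) renaming (all to allᵇ; any to anyᵇ)
open import Data.List using (List; []; _∷_; map)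
open import Data.List.Properties using (map-cong)
open import Data.List.Membership.Propositional using (_∈_; lose)
open import Data.List.Relation.Unary.All as All using (All; []; _∷_)
open import Data.List.Relation.Unary.All.Properties using (all⁺; map⁺)
open import Data.List.Relation.Unary.Any as Any using (Any; here; there; satisfied)
open import Data.List.Relation.Unary.Any.Properties using (any⁺; any⁻; map⁻; singleton⁻)
open import Data.List.Relation.Binary.Permutation.Propositional using (↭-sym)
open import Data.List.Relation.Binary.Permutation.Propositional.Properties using (All-resp-↭; Any-resp-↭)
open import Data.Product using (Σ; _,_)
open import Data.Sum using (_⊎_; inj₁; inj₂; [_,_]′)
open import Data.Empty using (⊥-elim)
open import Data.Vec.Functional using (Vector) renaming (_∷_ to _∷ᵉ_)
open import Function using (_∘_; const)
open import Function.Bundles using (Equivalence)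
open import Relation.Binary.PropositionalEquality using (_≡_; refl; sym; trans; cong; cong₂; subst)
open import Relation.Nullary using (¬_; yes; no)
open import Relation.Nullary.Decidable using (T?)

_⇒ᵇ_ : Bool → Bool → Bool
true  ⇒ᵇ y = y
false ⇒ᵇ y = true

⇒ᵇ-elim : ∀ x {y} → T (x ⇒ᵇ y) → T x → T y
⇒ᵇ-elim true x⇒y _ = x⇒y

⇒ᵇ-intro : ∀ x {y} → (T x → T y) → T (x ⇒ᵇ y)
⇒ᵇ-intro true  x→y = x→y _
⇒ᵇ-intro false _   = _

T-allᵇ-or : ∀ {a q} {A : Set a} {Q : Set q} (p : A → Bool) →
            (∀ x → T (p x) ⊎ Q) → ∀ xs → T (allᵇ p xs) ⊎ Q
T-allᵇ-or p p⊎Q []       = inj₁ _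
T-allᵇ-or p p⊎Q (x ∷ xs) with p⊎Q x | T-allᵇ-or p p⊎Q xs
... | inj₁ px | inj₁ pxs = inj₁ (Equivalence.from T-∧ (px , pxs))
... | inj₂ q  | _        = inj₂ q
... | inj₁ _  | inj₂ q   = inj₂ q

-- A finite carrier makes truth decidable, which is what the classical rules need.
record Structure : Set₁ where
  field
    Carrier  : Set
    elements : List Carrier
    complete : ∀ d → d ∈ elements
    _≈_      : Carrier → Carrier → Bool
    f        : Carrier → Carrier
    Λ        : (Carrier → Carrier) → Carrier
    Λ-cong   : ∀ {g h} → (∀ d → g d ≡ h d) → Λ g ≡ Λ h

module Semantics (𝓜 : Structure) where
  open Structure 𝓜

  Env : ℕ → Set
  Env = Vector Carrier

  ⟦_⟧ᵗ : ∀ {n} → Tm n → Env n → Carrier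
  ⟦ var i ⟧ᵗ η = η i
  ⟦ fun t ⟧ᵗ η = f (⟦ t ⟧ᵗ η)
  ⟦ lam t ⟧ᵗ η = Λ (λ d → ⟦ t ⟧ᵗ (d ∷ᵉ η))

  ⟦_⟧ᶠ : ∀ {n} → Fm n → Env n → Bool
  ⟦ t ≐ u ⟧ᶠ η = ⟦ t ⟧ᵗ η ≈ ⟦ u ⟧ᵗ η
  ⟦ A ⇒ B ⟧ᶠ η = ⟦ A ⟧ᶠ η ⇒ᵇ ⟦ B ⟧ᶠ η
  ⟦ A ∧ B ⟧ᶠ η = ⟦ A ⟧ᶠ η ∧ᵇ ⟦ B ⟧ᶠ η
  ⟦ A ∨ B ⟧ᶠ η = ⟦ A ⟧ᶠ η ∨ᵇ ⟦ B ⟧ᶠ η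
  ⟦ ⊥′ ⟧ᶠ    η = false
  ⟦ all A ⟧ᶠ η = allᵇ (λ d → ⟦ A ⟧ᶠ (d ∷ᵉ η)) elements
  ⟦ ex A ⟧ᶠ  η = anyᵇ (λ d → ⟦ A ⟧ᶠ (d ∷ᵉ η)) elements

  _⊨_ : ∀ {n} → Env n → Fm n → Set
  η ⊨ A = T (⟦ A ⟧ᶠ η)

  all-cong : ∀ {g h : Carrier → Bool} → (∀ d → g d ≡ h d) → allᵇ g elements ≡ allᵇ h elements
  all-cong g≗h = cong and (map-cong g≗h elements)

  any-cong : ∀ {g h : Carrier → Bool} → (∀ d → g d ≡ h d) → anyᵇ g elements ≡ anyᵇ h elements
  any-cong g≗h = cong or (map-cong g≗h elements)

  extR-agrees : ∀ {n m} (ρ : Ren n m) {η : Env m} {η′ : Env n} d → (∀ i → η (ρ i) ≡ η′ i) →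
                ∀ i → (d ∷ᵉ η) (extR ρ i) ≡ (d ∷ᵉ η′) i
  extR-agrees ρ d agree zero    = refl
  extR-agrees ρ d agree (suc i) = agree i

  ⟦⟧ᵗ-renT : ∀ {n m} (ρ : Ren n m) (t : Tm n) {η : Env m} {η′ : Env n} →
             (∀ i → η (ρ i) ≡ η′ i) → ⟦ renT ρ t ⟧ᵗ η ≡ ⟦ t ⟧ᵗ η′
  ⟦⟧ᵗ-renT ρ (var i) agree = agree i
  ⟦⟧ᵗ-renT ρ (fun t) agree = cong f (⟦⟧ᵗ-renT ρ t agree)
  ⟦⟧ᵗ-renT ρ (lam t) agree = Λ-cong λ d → ⟦⟧ᵗ-renT (extR ρ) t (extR-agrees ρ d agree)

  ⟦⟧ᶠ-renF : ∀ {n m} (ρ : Ren n m) (A : Fm n) {η : Env m} {η′ : Env n} →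
             (∀ i → η (ρ i) ≡ η′ i) → ⟦ renF ρ A ⟧ᶠ η ≡ ⟦ A ⟧ᶠ η′
  ⟦⟧ᶠ-renF ρ (t ≐ u) agree = cong₂ _≈_ (⟦⟧ᵗ-renT ρ t agree) (⟦⟧ᵗ-renT ρ u agree)
  ⟦⟧ᶠ-renF ρ (A ⇒ B) agree = cong₂ _⇒ᵇ_ (⟦⟧ᶠ-renF ρ A agree) (⟦⟧ᶠ-renF ρ B agree)
  ⟦⟧ᶠ-renF ρ (A ∧ B) agree = cong₂ _∧ᵇ_ (⟦⟧ᶠ-renF ρ A agree) (⟦⟧ᶠ-renF ρ B agree)
  ⟦⟧ᶠ-renF ρ (A ∨ B) agree = cong₂ _∨ᵇ_ (⟦⟧ᶠ-renF ρ A agree) (⟦⟧ᶠ-renF ρ B agree)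
  ⟦⟧ᶠ-renF ρ ⊥′      agree = refl
  ⟦⟧ᶠ-renF ρ (all A) agree = all-cong λ d → ⟦⟧ᶠ-renF (extR ρ) A (extR-agrees ρ d agree)
  ⟦⟧ᶠ-renF ρ (ex A)  agree = any-cong λ d → ⟦⟧ᶠ-renF (extR ρ) A (extR-agrees ρ d agree)

  extS-agrees : ∀ {n m} (σ : Sub n m) {η : Env m} {η′ : Env n} d → (∀ i → ⟦ σ i ⟧ᵗ η ≡ η′ i) →
                ∀ i → ⟦ extS σ i ⟧ᵗ (d ∷ᵉ η) ≡ (d ∷ᵉ η′) i
  extS-agrees σ d agree zero    = refl
  extS-agrees σ d agree (suc i) = trans (⟦⟧ᵗ-renT suc (σ i) λ _ → refl) (agree i)

  ⟦⟧ᵗ-subT : ∀ {n m} (σ : Sub n m) (t : Tm n) {η : Env m} {η′ : Env n} →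
             (∀ i → ⟦ σ i ⟧ᵗ η ≡ η′ i) → ⟦ subT σ t ⟧ᵗ η ≡ ⟦ t ⟧ᵗ η′
  ⟦⟧ᵗ-subT σ (var i) agree = agree i
  ⟦⟧ᵗ-subT σ (fun t) agree = cong f (⟦⟧ᵗ-subT σ t agree)
  ⟦⟧ᵗ-subT σ (lam t) agree = Λ-cong λ d → ⟦⟧ᵗ-subT (extS σ) t (extS-agrees σ d agree)

  ⟦⟧ᶠ-subF : ∀ {n m} (σ : Sub n m) (A : Fm n) {η : Env m} {η′ : Env n} →
             (∀ i → ⟦ σ i ⟧ᵗ η ≡ η′ i) → ⟦ subF σ A ⟧ᶠ η ≡ ⟦ A ⟧ᶠ η′
  ⟦⟧ᶠ-subF σ (t ≐ u) agree = cong₂ _≈_ (⟦⟧ᵗ-subT σ t agree) (⟦⟧ᵗ-subT σ u agree)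
  ⟦⟧ᶠ-subF σ (A ⇒ B) agree = cong₂ _⇒ᵇ_ (⟦⟧ᶠ-subF σ A agree) (⟦⟧ᶠ-subF σ B agree)
  ⟦⟧ᶠ-subF σ (A ∧ B) agree = cong₂ _∧ᵇ_ (⟦⟧ᶠ-subF σ A agree) (⟦⟧ᶠ-subF σ B agree)
  ⟦⟧ᶠ-subF σ (A ∨ B) agree = cong₂ _∨ᵇ_ (⟦⟧ᶠ-subF σ A agree) (⟦⟧ᶠ-subF σ B agree)
  ⟦⟧ᶠ-subF σ ⊥′      agree = refl
  ⟦⟧ᶠ-subF σ (all A) agree = all-cong λ d → ⟦⟧ᶠ-subF (extS σ) A (extS-agrees σ d agree)
  ⟦⟧ᶠ-subF σ (ex A)  agree = any-cong λ d → ⟦⟧ᶠ-subF (extS σ) A (extS-agrees σ d agree)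

  ⟦⟧ᶠ-[] : ∀ {n} (A : Fm (suc n)) (t : Tm n) (η : Env n) →
           ⟦ A [ t ] ⟧ᶠ η ≡ ⟦ A ⟧ᶠ (⟦ t ⟧ᵗ η ∷ᵉ η)
  ⟦⟧ᶠ-[] A t η = ⟦⟧ᶠ-subF (single t) A λ { zero → refl ; (suc i) → refl }

  ⟦⟧ᶠ-wkF : ∀ {n} (A : Fm n) (d : Carrier) (η : Env n) → ⟦ wkF A ⟧ᶠ (d ∷ᵉ η) ≡ ⟦ A ⟧ᶠ η
  ⟦⟧ᶠ-wkF A d η = ⟦⟧ᶠ-renF suc A λ _ → refl

  ⟦⟧ᶠ-liftF : ∀ {n} (k : ℕ) (A : Fm n) (η : Env (n + k)) →
              ⟦ liftF k A ⟧ᶠ η ≡ ⟦ A ⟧ᶠ (η ∘ (_↑ˡ k))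
  ⟦⟧ᶠ-liftF k A η = ⟦⟧ᶠ-renF (_↑ˡ k) A λ _ → refl

  module _ {n} {η : Env n} (d : Carrier) where

    ⊨-wkAll : ∀ {Γ} → All (η ⊨_) Γ → All ((d ∷ᵉ η) ⊨_) (map wkF Γ)
    ⊨-wkAll = map⁺ ∘ All.map λ {A} → subst T (sym (⟦⟧ᶠ-wkF A d η))

    ⊨-unwkAny : ∀ {Δ} → Any ((d ∷ᵉ η) ⊨_) (map wkF Δ) → Any (η ⊨_) Δ
    ⊨-unwkAny = Any.map (λ {A} → subst T (⟦⟧ᶠ-wkF A d η)) ∘ map⁻

  soundness : ∀ {n Γ Δ} → Prov n Γ Δ → (η : Env n) → All (η ⊨_) Γ → Any (η ⊨_) Δ
  soundness ax            η (⊨A ∷ []) = here ⊨A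
  soundness (cut _ ⊢A ⊢Γ) η ⊨Γ with soundness ⊢A η ⊨Γ
  ... | here ⊨A  = soundness ⊢Γ η (⊨A ∷ ⊨Γ)
  ... | there ⊨Δ = ⊨Δ
  soundness (weakL ⊢) η (_ ∷ ⊨Γ) = soundness ⊢ η ⊨Γ
  soundness (weakR ⊢) η ⊨Γ       = there (soundness ⊢ η ⊨Γ)
  soundness (contrL ⊢) η (⊨A ∷ ⊨Γ) = soundness ⊢ η (⊨A ∷ ⊨A ∷ ⊨Γ)
  soundness (contrR ⊢) η ⊨Γ with soundness ⊢ η ⊨Γ
  ... | here ⊨A          = here ⊨A
  ... | there (here ⊨A)  = here ⊨A
  ... | there (there ⊨Δ) = there ⊨Δ
  soundness (exchL Γ↭Γ′ ⊢) η ⊨Γ′ = soundness ⊢ η (All-resp-↭ (↭-sym Γ↭Γ′) ⊨Γ′)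
  soundness (exchR Δ↭Δ′ ⊢) η ⊨Γ  = Any-resp-↭ Δ↭Δ′ (soundness ⊢ η ⊨Γ)
  soundness ⊥L η (() ∷ _)
  soundness (⇒L ⊢A ⊢B) η (⊨A⇒B ∷ ⊨Γ) with soundness ⊢A η ⊨Γ
  ... | here ⊨A  = soundness ⊢B η (⇒ᵇ-elim _ ⊨A⇒B ⊨A ∷ ⊨Γ)
  ... | there ⊨Δ = ⊨Δ
  soundness (⇒R {A = A} ⊢B) η ⊨Γ with T? (⟦ A ⟧ᶠ η)
  ... | no ⊭A = here (⇒ᵇ-intro _ (⊥-elim ∘ ⊭A))
  ... | yes ⊨A with soundness ⊢B η (⊨A ∷ ⊨Γ)
  ...   | here ⊨B  = here (⇒ᵇ-intro _ (const ⊨B))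
  ...   | there ⊨Δ = there ⊨Δ
  soundness (∧L ⊢) η (⊨A∧B ∷ ⊨Γ) =
    let ⊨A , ⊨B = Equivalence.to T-∧ ⊨A∧B in soundness ⊢ η (⊨A ∷ ⊨B ∷ ⊨Γ)
  soundness (∧R ⊢A ⊢B) η ⊨Γ with soundness ⊢A η ⊨Γ | soundness ⊢B η ⊨Γ
  ... | here ⊨A  | here ⊨B  = here (Equivalence.from T-∧ (⊨A , ⊨B))
  ... | there ⊨Δ | _        = there ⊨Δ
  ... | here _   | there ⊨Δ = there ⊨Δ
  soundness (∨L ⊢A ⊢B) η (⊨A∨B ∷ ⊨Γ) with Equivalence.to T-∨ ⊨A∨B
  ... | inj₁ ⊨A = soundness ⊢A η (⊨A ∷ ⊨Γ)
  ... | inj₂ ⊨B = soundness ⊢B η (⊨B ∷ ⊨Γ)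
  soundness (∨R ⊢) η ⊨Γ with soundness ⊢ η ⊨Γ
  ... | here ⊨A          = here (Equivalence.from T-∨ (inj₁ ⊨A))
  ... | there (here ⊨B)  = here (Equivalence.from T-∨ (inj₂ ⊨B))
  ... | there (there ⊨Δ) = there ⊨Δ
  soundness (∀L {A = A} t ⊢) η (⊨∀A ∷ ⊨Γ) =
    soundness ⊢ η (subst T (sym (⟦⟧ᶠ-[] A t η)) ⊨A[t] ∷ ⊨Γ)
    where
    ⊨A[t] : (⟦ t ⟧ᵗ η ∷ᵉ η) ⊨ A
    ⊨A[t] = All.lookup (all⁺ _ elements ⊨∀A) (complete (⟦ t ⟧ᵗ η))
  soundness {Δ = _ ∷ Δ} (∀R {A = A} ⊢) η ⊨Γ =
    [ here , there ]′ (T-allᵇ-or (λ d → ⟦ A ⟧ᶠ (d ∷ᵉ η)) premise elements)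
    where
    premise : ∀ d → (d ∷ᵉ η) ⊨ A ⊎ Any (η ⊨_) Δ
    premise d with soundness ⊢ (d ∷ᵉ η) (⊨-wkAll d ⊨Γ)
    ... | here ⊨A  = inj₁ ⊨A
    ... | there ⊨Δ = inj₂ (⊨-unwkAny d ⊨Δ)
  soundness (∃L ⊢) η (⊨∃A ∷ ⊨Γ) =
    let d , ⊨A = satisfied (any⁻ _ elements ⊨∃A)
    in ⊨-unwkAny d (soundness ⊢ (d ∷ᵉ η) (⊨A ∷ ⊨-wkAll d ⊨Γ))
  soundness (∃R {A = A} t ⊢) η ⊨Γ with soundness ⊢ η ⊨Γ
  ... | here ⊨A[t] = here (any⁺ _ (lose (complete (⟦ t ⟧ᵗ η)) (subst T (⟦⟧ᶠ-[] A t η) ⊨A[t])))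
  ... | there ⊨Δ   = there ⊨Δ

data D : Set where
  a b c : D

model : Structure
model = record
  { Carrier  = D
  ; elements = a ∷ b ∷ c ∷ []
  ; complete = λ { a → here refl ; b → there (here refl) ; c → there (there (here refl)) }
  ; _≈_      = sameBlock
  ; f        = swap
  ; Λ        = λ g → fixesAB (g a) (g b)
  ; Λ-cong   = λ g≗h → cong₂ fixesAB (g≗h a) (g≗h b)
  }
  where
  sameBlock : D → D → Bool
  sameBlock c c = true
  sameBlock c _ = false
  sameBlock _ c = false
  sameBlock _ _ = true

  swap : D → D
  swap a = b
  swap b = a
  swap c = c

  fixesAB : D → D → D
  fixesAB a b = c
  fixesAB _ _ = a

open Semantics model

model⊨E : ∀ {n} (η : Env n) → All (η ⊨_) (E n)
model⊨E η = _ ∷ _ ∷ _ ∷ _ ∷ _ ∷ []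

model⊭Ext : ∀ {k} (η : Env k) → ¬ η ⊨ liftF k (Ext {0} v0 (fun v0))
model⊭Ext {k} η = subst T (⟦⟧ᶠ-liftF k (Ext v0 (fun v0)) η)

mainTheorem2 : Σ ℕ λ n → Σ (Tm (suc n)) λ t → Σ (Tm (suc n)) λ u →
    (k : ℕ) → ¬ Prov (n + k) (E (n + k)) (liftF k (Ext t u) ∷ [])
mainTheorem2 = 0 , v0 , fun v0 , λ k ⊢Ext →
  let η = λ _ → a in model⊭Ext η (singleton⁻ (soundness ⊢Ext η (model⊨E η)))
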